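{- Let $n \geq 1$ be an integer and $p$ a prime. Define $\lambda_n = 2$ if $n$ is odd and $\lambda_n = 3$ if $n$ is even. If $p > \frac{n+1}{\lambda_n}$, then $$\sum_{\nu \geq 1} \left\{\frac{n}{p^\nu}\right\} \leq 1.$$
   Context: $\{x\} = x - \lfloor x \rfloor$ denotes the fractional part. -}

module Defs where

open import Data.Nat as ℕ using (ℕ; zero; suc; _^_; NonZero)
open import Data.Nat.Properties using (m^n≢0)
open import Data.Integer using (+_)
open import Data.Rational using (ℚ; _/_; _-_; _+_; floor; 0ℚ)

frac : ℚ → ℚ
frac x = x - (floor x / 1)

lam : ℕ → ℕ
lam zero = 3
lam (suc zero) = 2
lam (suc (suc n)) = lam n

lam-nonZero : ∀ n → NonZero (lam n)
lam-nonZero zero = _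
lam-nonZero (suc zero) = _
lam-nonZero (suc (suc n)) = lam-nonZero n

term : (n p ν : ℕ) → .{{NonZero p}} → ℚ
term n p ν = frac (_/_ (+ n) (p ^ ν) {{m^n≢0 p ν}})

partialSum : (n p N : ℕ) → .{{NonZero p}} → ℚ
partialSum n p zero = 0ℚ
partialSum n p (suc N) = partialSum n p N + term n p (suc N)

{-# OPTIONS --safe #-}

-- Since {n/p^ν} = (n mod p^ν)/p^ν, the partial sum S_N is A_N/p^N with A_N a natural
-- number, and the claim is A_N ≤ p^N.  Once p^ν > n the terms are exactly n/p^ν, whose
-- tail beyond N sums to n/((p-1)p^N); so the inequality S_N ≤ 1 - n/((p-1)p^N), once it
-- holds at an N with n < p^(N+1), propagates to all larger N.  Write n = qp + r with r < p.
-- At N = 1 the inequality reads q + r ≤ p - 1.  The hypothesis gives q < λ_n ≤ 3, and the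
-- borderline cases q + r = p are excluded by the parity of n, except p = 2, n = 4, where
-- the inequality holds from N = 2 on.
module Submission where

open import Defs
open import Data.Nat using (ℕ; _≤_; _+_)
open import Data.Nat.Primality using (Prime; prime⇒nonZero)
open import Data.Integer using (+_)
open import Data.Rational using (ℚ; _/_; 1ℚ) renaming (_<_ to _<ℚ_; _≤_ to _≤ℚ_)

open import Data.Nat as ℕ using (zero; suc; _*_; _^_; _<_; NonZero; z≤n; s≤s)
open import Data.Nat.Properties
open import Data.Nat.DivMod using (_%_; m≡m%n+[m/n]*n; m<n⇒m%n≡m; m%n<n; %-congʳ; /-congˡ; /-congʳ; m/n*n≡m; m*n/o*n≡m/o)
  renaming (_/_ to _div_)
open import Data.Nat.Divisibility using (_∣_; _∣0; ∣-refl; ∣1⇒≡1; ∣m∣n⇒∣m+n; ∣m+n∣m⇒∣n; m∣m*n; n∣m*n)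
open import Data.Nat.Coprimality using (Coprime)
open import Data.Nat.GCD using (gcd; gcd[m,n]∣m; gcd[m,n]∣n; gcd[m,n]≢0; n/gcd[m,n]≢0)
open import Data.Nat.Primality using (prime; Irreducible; prime⇒irreducible)
import Data.Nat.Tactic.RingSolver as ℕ-Solver
open import Data.Integer as ℤ using (ℤ)
import Data.Integer.Properties as ℤ
open import Data.Integer.DivMod using (div-pos-is-/ℕ)
open import Data.Integer.Tactic.RingSolver using (solve-∀)
open import Data.Rational as ℚ using (mkℚ+; floor; toℚᵘ)
open import Data.Rational.Properties using (toℚᵘ-fromℚᵘ; toℚᵘ-homo-+; toℚᵘ-homo‿-; toℚᵘ-mono-<; toℚᵘ-cancel-≤)
open import Data.Rational.Unnormalised as ℚᵘ using (mkℚᵘ; *≡*; *≤*; _≃_) renaming (_/_ to _/ᵘ_)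
import Data.Rational.Unnormalised.Properties as ℚᵘ
open import Data.Product using (_×_; _,_)
open import Data.Sum using (_⊎_; inj₁; inj₂)
open import Data.Empty using (⊥-elim)
open import Relation.Binary.PropositionalEquality

floor-mkℚ+ : ∀ a d .{{_ : NonZero d}} .(c : Coprime a d) → floor (mkℚ+ a d c) ≡ + (a div d)
floor-mkℚ+ a (suc d) c = div-pos-is-/ℕ (+ a) (suc d)

floor-/ : ∀ a d .{{_ : NonZero d}} → floor (+ a / d) ≡ + (a div d)
floor-/ a d = trans (floor-mkℚ+ (a div g) (d div g) _) (cong +_ reduced)
  where
  g : ℕ
  g = gcd a d
  instance
    g≢0 : NonZero g
    g≢0 = ℕ.≢-nonZero (gcd[m,n]≢0 a d (inj₂ (ℕ.≢-nonZero⁻¹ d)))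
    d/g≢0 : NonZero (d div g)
    d/g≢0 = ℕ.≢-nonZero (n/gcd[m,n]≢0 a d)
    d/g*g≢0 : NonZero ((d div g) * g)
    d/g*g≢0 = m*n≢0 (d div g) g
  reduced : (a div g) div (d div g) ≡ a div d
  reduced = begin
    (a div g) div (d div g)             ≡⟨ m*n/o*n≡m/o (a div g) g (d div g) ⟨
    (a div g * g) div (d div g * g)     ≡⟨ /-congˡ (m/n*n≡m (gcd[m,n]∣m a d)) ⟩
    a div (d div g * g)                 ≡⟨ /-congʳ (m/n*n≡m (gcd[m,n]∣n a d)) ⟩
    a div d                             ∎
    where open ≡-Reasoning

toℚᵘ-/ : ∀ i d .{{_ : NonZero d}} → toℚᵘ (i / d) ≃ i /ᵘ d
toℚᵘ-/ i (suc d) = toℚᵘ-fromℚᵘ (mkℚᵘ i d)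

pos-+-* : ∀ a b c → + (a + b * c) ≡ + a ℤ.+ + b ℤ.* + c
pos-+-* a b c = trans (ℤ.pos-+ a (b * c)) (cong (ℤ._+_ (+ a)) (ℤ.pos-* b c))

[r+q*d]/d-q≃r/d : ∀ (r q : ℤ) d .{{_ : NonZero d}} → (r ℤ.+ q ℤ.* + d) /ᵘ d ℚᵘ.- q /ᵘ 1 ≃ r /ᵘ d
[r+q*d]/d-q≃r/d r q d@(suc _) = *≡* (trans (identity r q (+ d)) (cong (r ℤ.*_) (ℤ.pos-* d 1)))
  where
  identity : ∀ (r q D : ℤ) → ((r ℤ.+ q ℤ.* D) ℤ.* ℤ.1ℤ ℤ.+ (ℤ.- q) ℤ.* D) ℤ.* D ≡ r ℤ.* (D ℤ.* ℤ.1ℤ)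
  identity = solve-∀

frac-/ : ∀ a d .{{_ : NonZero d}} → toℚᵘ (frac (+ a / d)) ≃ + (a % d) /ᵘ d
frac-/ a d = begin
  toℚᵘ (x ℚ.- floor x / 1)              ≈⟨ toℚᵘ-homo-+ x (ℚ.- (floor x / 1)) ⟩
  toℚᵘ x ℚᵘ.+ toℚᵘ (ℚ.- (floor x / 1))  ≈⟨ ℚᵘ.+-congʳ (toℚᵘ x) (toℚᵘ-homo‿- (floor x / 1)) ⟩
  toℚᵘ x ℚᵘ.- toℚᵘ (floor x / 1)        ≈⟨ ℚᵘ.+-cong (toℚᵘ-/ (+ a) d) (ℚᵘ.-‿cong (toℚᵘ-/ (floor x) 1)) ⟩
  + a /ᵘ d ℚᵘ.- floor x /ᵘ 1            ≡⟨ cong₂ (λ i j → i /ᵘ d ℚᵘ.- j /ᵘ 1) a≡r+qd (floor-/ a d) ⟩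
  (+ r ℤ.+ + q ℤ.* + d) /ᵘ d ℚᵘ.- + q /ᵘ 1 ≈⟨ [r+q*d]/d-q≃r/d (+ r) (+ q) d ⟩
  + r /ᵘ d                              ∎
  where
  open ℚᵘ.≃-Reasoning
  x : ℚ
  x = + a / d
  r q : ℕ
  r = a % d
  q = a div d
  a≡r+qd : + a ≡ + r ℤ.+ + q ℤ.* + d
  a≡r+qd = trans (cong +_ (m≡m%n+[m/n]*n a d)) (pos-+-* r q d)

/ᵘ-+-rescale : ∀ (x y : ℤ) P p .{{_ : NonZero P}} .{{_ : NonZero p}} .{{_ : NonZero (p * P)}} →
               x /ᵘ P ℚᵘ.+ y /ᵘ (p * P) ≃ (y ℤ.+ x ℤ.* + p) /ᵘ (p * P)
/ᵘ-+-rescale x y P@(suc _) p@(suc _) =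
  *≡* (subst₂ (λ pP PpP → (x ℤ.* pP ℤ.+ y ℤ.* + P) ℤ.* pP ≡ (y ℤ.+ x ℤ.* + p) ℤ.* PpP)
              (sym (ℤ.pos-* p P)) (sym (trans (ℤ.pos-* P (p * P)) (cong (ℤ._*_ (+ P)) (ℤ.pos-* p P))))
              (identity x y (+ P) (+ p)))
  where
  identity : ∀ (x y P p : ℤ) → (x ℤ.* (p ℤ.* P) ℤ.+ y ℤ.* P) ℤ.* (p ℤ.* P) ≡ (y ℤ.+ x ℤ.* p) ℤ.* (P ℤ.* (p ℤ.* P))
  identity = solve-∀

scaledPartialSum : (n p N : ℕ) .{{_ : NonZero p}} → ℕ
scaledPartialSum n p zero = 0
scaledPartialSum n p (suc N) = _%_ n (p ^ suc N) {{m^n≢0 p (suc N)}} + scaledPartialSum n p N * p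

partialSum≃scaled : ∀ n p N .{{_ : NonZero p}} →
                    toℚᵘ (partialSum n p N) ≃ _/ᵘ_ (+ scaledPartialSum n p N) (p ^ N) {{m^n≢0 p N}}
partialSum≃scaled n p zero = ℚᵘ.≃-refl
partialSum≃scaled n p (suc N) = begin
  toℚᵘ (partialSum n p N ℚ.+ term n p (suc N))                   ≈⟨ toℚᵘ-homo-+ (partialSum n p N) (term n p (suc N)) ⟩
  toℚᵘ (partialSum n p N) ℚᵘ.+ toℚᵘ (term n p (suc N))          ≈⟨ ℚᵘ.+-cong (partialSum≃scaled n p N) (frac-/ n (p ^ suc N)) ⟩
  + A /ᵘ p ^ N ℚᵘ.+ + r /ᵘ p ^ suc N                              ≈⟨ /ᵘ-+-rescale (+ A) (+ r) (p ^ N) p ⟩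
  (+ r ℤ.+ + A ℤ.* + p) /ᵘ p ^ suc N                              ≡⟨ cong (_/ᵘ p ^ suc N) (pos-+-* r A p) ⟨
  + (r + A * p) /ᵘ p ^ suc N                                      ∎
  where
  open ℚᵘ.≃-Reasoning
  instance
    p^N≢0 : NonZero (p ^ N)
    p^N≢0 = m^n≢0 p N
    p^1+N≢0 : NonZero (p ^ suc N)
    p^1+N≢0 = m^n≢0 p (suc N)
  A r : ℕ
  A = scaledPartialSum n p N
  r = n % p ^ suc N

module _ (m n : ℕ) where

  private
    p : ℕ
    p = suc m

    A : ℕ → ℕ
    A N = scaledPartialSum n p N

  -- With S_N = A N / p ^ N, this says S_N ≤ 1 - n / ((p - 1) p ^ N).
  Slack : ℕ → Set
  Slack N = A N * m + n ≤ p ^ N * m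

  slack-suc : ∀ N → n < p ^ suc N → Slack N → Slack (suc N)
  slack-suc N n<p^1+N slack = begin
    (n % p ^ suc N + A N * p) * m + n  ≡⟨ cong (λ r → (r + A N * p) * m + n) (m<n⇒m%n≡m n<p^1+N) ⟩
    (n + A N * p) * m + n              ≡⟨ identity (A N) m n ⟩
    p * (A N * m + n)                  ≤⟨ *-monoʳ-≤ p slack ⟩
    p * (p ^ N * m)                    ≡⟨ *-assoc p (p ^ N) m ⟨
    p ^ suc N * m                      ∎
    where
    open ≤-Reasoning
    instance
      p^1+N≢0 : NonZero (p ^ suc N)
      p^1+N≢0 = m^n≢0 p (suc N)
    identity : ∀ a m n → (n + a * suc m) * m + n ≡ suc m * (a * m + n)
    identity = ℕ-Solver.solve-∀

  slack-from : ∀ {K N} → n < p ^ suc K → Slack K → K ℕ.≤′ N → Slack N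
  slack-from n<p^1+K slack ℕ.≤′-refl = slack
  slack-from {N = suc N} n<p^1+K slack (ℕ.≤′-step K≤′N) =
    slack-suc N (<-≤-trans n<p^1+K (^-monoʳ-≤ p (s≤s (≤′⇒≤ K≤′N)))) (slack-from n<p^1+K slack K≤′N)

  slack⇒bounded : .{{_ : NonZero m}} → ∀ N → Slack N → A N ≤ p ^ N
  slack⇒bounded N slack = *-cancelʳ-≤ (A N) (p ^ N) m (≤-trans (m≤m+n (A N * m) n) slack)

  bounded-from : .{{_ : NonZero m}} → ∀ {K} → n < p ^ suc K → Slack K → ∀ N → K ≤ N → A N ≤ p ^ N
  bounded-from n<p^1+K slack N K≤N = slack⇒bounded N (slack-from n<p^1+K slack (≤⇒≤′ K≤N))

  digitSum<p⇒slack : n div p + n % p < p → Slack 1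
  digitSum<p⇒slack q+r<p = begin
    A 1 * m + n          ≡⟨ cong (λ k → k * m + n) (trans (+-identityʳ _) (%-congʳ {o = n} (*-identityʳ p))) ⟩
    r * m + n            ≡⟨ cong (_+_ (r * m)) (m≡m%n+[m/n]*n n p) ⟩
    r * m + (r + q * p)  ≡⟨ identity r q m ⟩
    (q + r) * p          ≤⟨ *-monoˡ-≤ p (≤-pred q+r<p) ⟩
    m * p                ≡⟨ *-comm m p ⟩
    p * m                ≡⟨ cong (_* m) (*-identityʳ p) ⟨
    p ^ 1 * m            ∎
    where
    open ≤-Reasoning
    q r : ℕ
    q = n div p
    r = n % p
    identity : ∀ r q m → r * m + (r + q * suc m) ≡ (q + r) * suc m
    identity = ℕ-Solver.solve-∀

  digitSum<p⇒<p² : n div p + n % p < p → n < p ^ 2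
  digitSum<p⇒<p² q+r<p = begin-strict
    n          ≡⟨ m≡m%n+[m/n]*n n p ⟩
    r + q * p  <⟨ +-monoˡ-< (q * p) (m%n<n n p) ⟩
    suc q * p  ≤⟨ *-monoˡ-≤ p (≤-<-trans (m≤m+n q r) q+r<p) ⟩
    p * p      ≡⟨ cong (p *_) (*-identityʳ p) ⟨
    p ^ 2      ∎
    where
    open ≤-Reasoning
    q r : ℕ
    q = n div p
    r = n % p

  digitSum<p⇒bounded : .{{_ : NonZero m}} → n div p + n % p < p → ∀ N → A N ≤ p ^ N
  digitSum<p⇒bounded q+r<p zero = z≤n
  digitSum<p⇒bounded q+r<p (suc N) =
    bounded-from (digitSum<p⇒<p² q+r<p) (digitSum<p⇒slack q+r<p) (suc N) (s≤s z≤n)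

-- The exception in digitSum<p: here Slack first holds at N = 2 rather than N = 1.
bounded-4-2 : ∀ N → scaledPartialSum 4 2 N ≤ 2 ^ N
bounded-4-2 0 = z≤n
bounded-4-2 1 = z≤n
bounded-4-2 (suc (suc N)) = bounded-from 1 4 (m≤m+n 5 3) ≤-refl (suc (suc N)) (s≤s (s≤s z≤n))

lam-parity : ∀ n → lam n ≡ 2 ⊎ (lam n ≡ 3 × 2 ∣ n)
lam-parity zero = inj₂ (refl , 2 ∣0)
lam-parity (suc zero) = inj₁ refl
lam-parity (suc (suc n)) with lam-parity n
... | inj₁ odd = inj₁ odd
... | inj₂ (even , 2∣n) = inj₂ (even , ∣m∣n⇒∣m+n ∣-refl 2∣n)

quotient<lam : ∀ n p q r → n ≡ r + q * p → n + 1 < p * lam n → q < lam n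
quotient<lam n p@(suc _) q r n≡r+qp n+1<pλ = *-cancelʳ-< p q (lam n) (begin-strict
  q * p      ≤⟨ m≤n+m (q * p) r ⟩
  r + q * p  ≡⟨ n≡r+qp ⟨
  n          <⟨ m<m+n n (s≤s z≤n) ⟩
  n + 1      <⟨ n+1<pλ ⟩
  p * lam n  ≡⟨ *-comm p (lam n) ⟩
  lam n * p  ∎)
  where open ≤-Reasoning
quotient<lam n zero q r n≡r+qp n+1<pλ = ⊥-elim (<⇒≱ n+1<pλ z≤n)

digitSum<p-odd : ∀ n p q r → r < p → n ≡ r + q * p → q < 2 → n + 1 < p * 2 → q + r < p
digitSum<p-odd n p 0 r r<p n≡r+qp q<2 n+1<2p = r<p
digitSum<p-odd n p 1 r r<p n≡r+qp q<2 n+1<2p =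
  +-cancelʳ-< p (suc r) p (subst₂ _<_ (trans (cong (_+ 1) n≡r+qp) (identityˡ r p)) (identityʳ p) n+1<2p)
  where
  identityˡ : ∀ r p → r + 1 * p + 1 ≡ suc r + p
  identityˡ = ℕ-Solver.solve-∀
  identityʳ : ∀ p → p * 2 ≡ p + p
  identityʳ = ℕ-Solver.solve-∀
digitSum<p-odd n p (suc (suc q)) r r<p n≡r+qp (s≤s (s≤s ())) n+1<2p

digitSum<p-even : ∀ n p q r → Irreducible p → r < p → n ≡ r + q * p → q < 3 → n + 1 < p * 3 → 2 ∣ n →
                  q + r < p ⊎ (p ≡ 2 × n ≡ 4)
digitSum<p-even n p 0 r irr r<p n≡r+qp q<3 n+1<3p 2∣n = inj₁ r<p
digitSum<p-even n p 1 r irr r<p n≡r+qp q<3 n+1<3p 2∣n with m≤n⇒m<n∨m≡n r<p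
... | inj₁ 1+r<p = inj₁ 1+r<p
... | inj₂ refl = ⊥-elim (1+n≢n (∣1⇒≡1 2∣1))
  where
  identity : ∀ r → r + 1 * suc r ≡ r * 2 + 1
  identity = ℕ-Solver.solve-∀
  2∣1 : 2 ∣ 1
  2∣1 = ∣m+n∣m⇒∣n (subst (2 ∣_) (trans n≡r+qp (identity r)) 2∣n) (n∣m*n r)
digitSum<p-even n p 2 r irr r<p n≡r+qp q<3 n+1<3p 2∣n with m≤n⇒m<n∨m≡n 2+r≤p
  where
  identityˡ : ∀ r p → suc (r + 2 * p + 1) ≡ 2 + r + 2 * p
  identityˡ = ℕ-Solver.solve-∀
  identityʳ : ∀ p → p * 3 ≡ p + 2 * p
  identityʳ = ℕ-Solver.solve-∀
  2+r≤p : 2 + r ≤ p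
  2+r≤p = +-cancelʳ-≤ (2 * p) (2 + r) p
            (subst₂ _≤_ (trans (cong (λ k → suc (k + 1)) n≡r+qp) (identityˡ r p)) (identityʳ p) n+1<3p)
... | inj₁ 2+r<p = inj₁ 2+r<p
... | inj₂ refl with irr 2∣2+r
  where
  2∣2+r : 2 ∣ 2 + r
  2∣2+r = ∣m∣n⇒∣m+n ∣-refl (∣m+n∣m⇒∣n (subst (2 ∣_) (trans n≡r+qp (+-comm r (2 * (2 + r)))) 2∣n) (m∣m*n (2 + r)))
...   | inj₁ ()
...   | inj₂ refl = inj₂ (refl , n≡r+qp)
digitSum<p-even n p (suc (suc (suc q))) r irr r<p n≡r+qp (s≤s (s≤s (s≤s ()))) n+1<3p 2∣n

digitSum<p : ∀ n p .{{_ : NonZero p}} → Irreducible p → n + 1 < p * lam n →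
             n div p + n % p < p ⊎ (p ≡ 2 × n ≡ 4)
digitSum<p n p irr n+1<pλ = byParity (lam-parity n)
  where
  q r : ℕ
  q = n div p
  r = n % p
  n≡r+qp : n ≡ r + q * p
  n≡r+qp = m≡m%n+[m/n]*n n p
  q<λ : q < lam n
  q<λ = quotient<lam n p q r n≡r+qp n+1<pλ
  byParity : lam n ≡ 2 ⊎ (lam n ≡ 3 × 2 ∣ n) → q + r < p ⊎ (p ≡ 2 × n ≡ 4)
  byParity (inj₁ odd) = inj₁ (digitSum<p-odd n p q r (m%n<n n p) n≡r+qp
    (subst (q <_) odd q<λ) (subst (λ l → n + 1 < p * l) odd n+1<pλ))
  byParity (inj₂ (even , 2∣n)) = digitSum<p-even n p q r irr (m%n<n n p) n≡r+qp
    (subst (q <_) even q<λ) (subst (λ l → n + 1 < p * l) even n+1<pλ) 2∣n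

scaledPartialSum≤p^N : ∀ n p (pp : Prime p) → n + 1 < p * lam n →
                       ∀ N → scaledPartialSum n p N {{prime⇒nonZero pp}} ≤ p ^ N
scaledPartialSum≤p^N n 0 (prime {{()}} _)
scaledPartialSum≤p^N n 1 (prime {{()}} _)
scaledPartialSum≤p^N n p@(suc m@(suc _)) pp n+1<pλ with digitSum<p n p (prime⇒irreducible pp) n+1<pλ
... | inj₁ q+r<p = digitSum<p⇒bounded m n q+r<p
... | inj₂ (refl , refl) = bounded-4-2

/<⇒<* : ∀ a b L .{{_ : NonZero L}} → + a / L <ℚ + b / 1 → a < b * L
/<⇒<* a b L@(suc _) a/L<b =
  ℤ.drop‿+<+ (subst₂ ℤ._<_ (ℤ.*-identityʳ (+ a)) (sym (ℤ.pos-* b L)) (ℚᵘ.drop-*<* a/L<ᵘb))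
  where
  a/L<ᵘb : + a /ᵘ L ℚᵘ.< + b /ᵘ 1
  a/L<ᵘb = ℚᵘ.<-respʳ-≃ (toℚᵘ-/ (+ b) 1) (ℚᵘ.<-respˡ-≃ (toℚᵘ-/ (+ a) L) (toℚᵘ-mono-< a/L<b))

/ᵘ≤1 : ∀ a P .{{_ : NonZero P}} → a ≤ P → + a /ᵘ P ℚᵘ.≤ ℚᵘ.1ℚᵘ
/ᵘ≤1 a P@(suc _) a≤P = *≤* (subst₂ ℤ._≤_ (sym (ℤ.*-identityʳ (+ a))) (sym (ℤ.*-identityˡ (+ P))) (ℤ.+≤+ a≤P))

lemma1 : (n p : ℕ) → 1 ≤ n → (pp : Prime p) →
    _/_ (+ (n + 1)) (lam n) {{lam-nonZero n}} <ℚ (+ p) / 1 →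
    (N : ℕ) → partialSum n p N {{prime⇒nonZero pp}} ≤ℚ 1ℚ
lemma1 n p _ pp n+1/λ<p N = toℚᵘ-cancel-≤ (begin
  toℚᵘ (partialSum n p N)            ≃⟨ partialSum≃scaled n p N ⟩
  + scaledPartialSum n p N /ᵘ p ^ N  ≤⟨ /ᵘ≤1 _ (p ^ N) (scaledPartialSum≤p^N n p pp n+1<pλ N) ⟩
  ℚᵘ.1ℚᵘ                             ∎)
  where
  open ℚᵘ.≤-Reasoning
  instance
    p≢0 : NonZero p
    p≢0 = prime⇒nonZero pp
    p^N≢0 : NonZero (p ^ N)
    p^N≢0 = m^n≢0 p N
  n+1<pλ : n + 1 < p * lam n
  n+1<pλ = /<⇒<* (n + 1) p (lam n) {{lam-nonZero n}} n+1/λ<p
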